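{- Let $\mathcal{A}\subseteq\omega^\omega$ be a non-empty countable class which is downwards closed under Turing reducibility. Then the following are equivalent: (i) $\mathcal{A}$ is a splitting class. (ii) For every $f\in\mathcal{A}$ and every finite subset $\mathcal{B}\subseteq\{g\in\mathcal{A}\mid g\not\le_T f\}$ there exists $h\in\mathcal{A}$ such that $h>_T f$ and for all $g\in\mathcal{B}$: $g\oplus h\notin\mathcal{A}$. (iii) For every $f\in\mathcal{A}$ there exists $h\in\mathcal{A}$ such that $h\not\le_T f$, and for every $f\in\mathcal{A}$, every finite subset $\mathcal{B}\subseteq\{g\in\mathcal{A}\mid g\not\le_T f\}$ and every $h_0\in\{g\in\mathcal{A}\mid g\not\le_T f\}$ there exists $h_1\in\mathcal{A}$ such that $h_1>_T f$, $h_0\oplus h_1\notin\mathcal{A}$ and for all $g\in\mathcal{B}$: $h_1\not\ge_T g$.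
   Context: For $f,g\in\omega^\omega$, $f\oplus g$ is the join: $(f\oplus g)(2n)=f(n)$, $(f\oplus g)(2n+1)=g(n)$. "Countable" includes finite. A non-empty countable class $\mathcal{A}\subseteq\omega^\omega$ which is downwards closed under Turing reducibility is a splitting class if for every $f\in\mathcal{A}$ and every finite subset $\mathcal{B}\subseteq\{g\in\mathcal{A}\mid g\not\le_T f\}$ there exist $h_0,h_1\in\mathcal{A}$ such that $h_0,h_1\ge_T f$, $h_0\oplus h_1\notin\mathcal{A}$, and for all $g\in\mathcal{B}$: $g\oplus h_0\notin\mathcal{A}$ and $g\oplus h_1\notin\mathcal{A}$. -}

module Defs where

open import Data.Nat using (ℕ; zero; suc; _<_)
open import Data.Fin using (Fin)
open import Data.Vec using (Vec; []; _∷_; lookup)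
open import Data.List using (List)
open import Data.List.Relation.Unary.All using (All)
open import Data.Product using (Σ; ∃; _×_; _,_)
open import Relation.Binary.PropositionalEquality using (_≡_)
open import Relation.Nullary using (¬_)
open import Function.Bundles using (_⇔_)

Baire : Set
Baire = ℕ → ℕ

-- Oracle partial recursive functions (Kleene's μ-recursive functions
-- relative to an oracle). Code n = programs of arity n.

data Code : ℕ → Set where
  zer  : ∀ {n} → Code n
  succ : Code 1
  prj  : ∀ {n} → Fin n → Code n
  orc  : Code 1
  comp : ∀ {m n} → Code m → Vec (Code n) m → Code n
  prec : ∀ {n} → Code n → Code (suc (suc n)) → Code (suc n)
  mu   : ∀ {n} → Code (suc n) → Code n

mutual
  data Eval (O : Baire) : ∀ {n} → Code n → Vec ℕ n → ℕ → Set where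
    ev-zer  : ∀ {n} {xs : Vec ℕ n} → Eval O zer xs 0
    ev-succ : ∀ {x} → Eval O succ (x ∷ []) (suc x)
    ev-prj  : ∀ {n} {i : Fin n} {xs} → Eval O (prj i) xs (lookup xs i)
    ev-orc  : ∀ {x} → Eval O orc (x ∷ []) (O x)
    ev-comp : ∀ {m n} {f : Code m} {gs : Vec (Code n) m} {xs ys y} →
              EvalAll O gs xs ys → Eval O f ys y → Eval O (comp f gs) xs y
    ev-prec0 : ∀ {n} {g : Code n} {h} {xs y} →
               Eval O g xs y → Eval O (prec g h) (0 ∷ xs) y
    ev-precS : ∀ {n} {g : Code n} {h} {k xs r y} →
               Eval O (prec g h) (k ∷ xs) r → Eval O h (k ∷ r ∷ xs) y →
               Eval O (prec g h) (suc k ∷ xs) y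
    ev-mu   : ∀ {n} {f : Code (suc n)} {xs y} →
              Eval O f (y ∷ xs) 0 →
              (∀ z → z < y → Σ ℕ (λ k → Eval O f (z ∷ xs) (suc k))) →
              Eval O (mu f) xs y

  data EvalAll (O : Baire) {n : ℕ} : ∀ {m} → Vec (Code n) m → Vec ℕ n → Vec ℕ m → Set where
    []  : ∀ {xs} → EvalAll O [] xs []
    _∷_ : ∀ {m} {g : Code n} {gs : Vec (Code n) m} {xs y ys} →
          Eval O g xs y → EvalAll O gs xs ys → EvalAll O (g ∷ gs) xs (y ∷ ys)

_≤T_ : Baire → Baire → Set
f ≤T g = Σ (Code 1) (λ c → ∀ n → Eval g c (n ∷ []) (f n))

_<T_ : Baire → Baire → Set
f <T g = f ≤T g × ¬ (g ≤T f)

-- Join: (f ⊕ g)(2n) = f n, (f ⊕ g)(2n+1) = g n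
_⊕_ : Baire → Baire → Baire
(f ⊕ g) zero = f 0
(f ⊕ g) (suc zero) = g 0
(f ⊕ g) (suc (suc n)) = ((λ k → f (suc k)) ⊕ (λ k → g (suc k))) n

NonEmpty : (Baire → Set) → Set
NonEmpty A = Σ Baire A

-- countable (including finite); for a non-empty class this is the same
-- as being the range of some ℕ-indexed sequence (up to extensional equality)
Countable : (Baire → Set) → Set
Countable A = Σ (ℕ → Baire) (λ e → ∀ f → A f ⇔ ∃ (λ n → ∀ m → e n m ≡ f m))

DownClosed : (Baire → Set) → Set
DownClosed A = ∀ f g → A g → f ≤T g → A f

FinSubAbove : (Baire → Set) → Baire → List Baire → Set
FinSubAbove A f B = All (λ g → A g × ¬ (g ≤T f)) B

SplittingCondition : (Baire → Set) → Set
SplittingCondition A =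
  ∀ f → A f → ∀ (B : List Baire) → FinSubAbove A f B →
  Σ Baire λ h₀ → Σ Baire λ h₁ →
    A h₀ × A h₁ × f ≤T h₀ × f ≤T h₁ × ¬ A (h₀ ⊕ h₁) ×
    All (λ g → ¬ A (g ⊕ h₀) × ¬ A (g ⊕ h₁)) B

IsSplittingClass : (Baire → Set) → Set
IsSplittingClass A = NonEmpty A × Countable A × DownClosed A × SplittingCondition A

ConditionII : (Baire → Set) → Set
ConditionII A =
  ∀ f → A f → ∀ (B : List Baire) → FinSubAbove A f B →
  Σ Baire λ h → A h × f <T h × All (λ g → ¬ A (g ⊕ h)) B

ConditionIII : (Baire → Set) → Set
ConditionIII A =
  (∀ f → A f → Σ Baire λ h → A h × ¬ (h ≤T f)) ×
  (∀ f → A f → ∀ (B : List Baire) → FinSubAbove A f B →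
   ∀ h₀ → A h₀ → ¬ (h₀ ≤T f) →
   Σ Baire λ h₁ → A h₁ × f <T h₁ × ¬ A (h₀ ⊕ h₁) × All (λ g → ¬ (g ≤T h₁)) B)

-- (i) ⇒ (ii): take h = h₀; if h₀ ≤T f ≤T h₁ then h₀ ⊕ h₁ ≡T h₁ would lie in A.
-- (ii) ⇒ (i): apply (ii) twice, the second time with the first witness h₀ added to B.
-- (ii) ⇒ (iii): apply (ii) with h₀ added to B; g ⊕ h₁ ∉ A forces g ≰T h₁, since otherwise
-- g ⊕ h₁ ≡T h₁ ∈ A.
-- (iii) ⇒ (ii): induction on B. For g ∷ B, use g as h₀ in (iii) to get f <T h₁ with
-- g ⊕ h₁ ∉ A and no member of B below h₁; so B is still admissible over h₁ and the
-- induction hypothesis gives h >T h₁ avoiding B. Downward closure turns g ⊕ h₁ ∉ A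
-- into g ⊕ h ∉ A because g ⊕ h₁ ≤T g ⊕ h.
module Submission where

open import Defs
open import Data.Nat using (ℕ; zero; suc)
open import Data.Fin using (zero; suc)
open import Data.Vec using (Vec; []; _∷_)
open import Data.List using ([]; _∷_)
open import Data.List.Relation.Unary.All as All using (All; []; _∷_)
open import Data.Product using (Σ; _×_; _,_; proj₁)
open import Function.Bundles using (_⇔_; mk⇔)
open import Relation.Binary.PropositionalEquality using (_≡_; refl; sym; cong; subst)
open import Relation.Nullary using (¬_)

mutual
  substOracle : ∀ {n} → Code 1 → Code n → Code n
  substOracle c zer         = zer
  substOracle c succ        = succ
  substOracle c (prj i)     = prj i
  substOracle c orc         = c
  substOracle c (comp f gs) = comp (substOracle c f) (substOracleAll c gs)
  substOracle c (prec g h)  = prec (substOracle c g) (substOracle c h)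
  substOracle c (mu f)      = mu (substOracle c f)

  substOracleAll : ∀ {n m} → Code 1 → Vec (Code n) m → Vec (Code n) m
  substOracleAll c []       = []
  substOracleAll c (g ∷ gs) = substOracle c g ∷ substOracleAll c gs

module EvalSubstOracle {g h : Baire} (c : Code 1) (c-computes-g : ∀ n → Eval h c (n ∷ []) (g n)) where
  mutual
    Eval-substOracle : ∀ {n} {d : Code n} {xs y} → Eval g d xs y → Eval h (substOracle c d) xs y
    Eval-substOracle ev-zer           = ev-zer
    Eval-substOracle ev-succ          = ev-succ
    Eval-substOracle ev-prj           = ev-prj
    Eval-substOracle (ev-orc {x})     = c-computes-g x
    Eval-substOracle (ev-comp es e)   = ev-comp (EvalAll-substOracle es) (Eval-substOracle e)
    Eval-substOracle (ev-prec0 e)     = ev-prec0 (Eval-substOracle e)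
    Eval-substOracle (ev-precS e₁ e₂) = ev-precS (Eval-substOracle e₁) (Eval-substOracle e₂)
    Eval-substOracle (ev-mu e below)  = ev-mu (Eval-substOracle e) (λ z z<y → Eval-substOracle-suc (below z z<y))

    Eval-substOracle-suc : ∀ {n} {d : Code n} {xs} → Σ ℕ (λ k → Eval g d xs (suc k)) →
               Σ ℕ (λ k → Eval h (substOracle c d) xs (suc k))
    Eval-substOracle-suc (k , e) = k , Eval-substOracle e

    EvalAll-substOracle : ∀ {n m} {gs : Vec (Code n) m} {xs ys} →
                          EvalAll g gs xs ys → EvalAll h (substOracleAll c gs) xs ys
    EvalAll-substOracle []       = []
    EvalAll-substOracle (e ∷ es) = Eval-substOracle e ∷ EvalAll-substOracle es

≤T-refl : ∀ {f} → f ≤T f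
≤T-refl = orc , λ n → ev-orc

≤T-trans : ∀ {f g h} → f ≤T g → g ≤T h → f ≤T h
≤T-trans (c , c-computes-f) (d , d-computes-g) =
  substOracle d c , λ n → EvalSubstOracle.Eval-substOracle d d-computes-g (c-computes-f n)

<T-≤T-trans : ∀ {f g h} → f <T g → g ≤T h → f <T h
<T-≤T-trans (f≤g , g≰f) g≤h = ≤T-trans f≤g g≤h , λ h≤f → g≰f (≤T-trans g≤h h≤f)

_computes_ : Code 1 → (ℕ → ℕ) → Set
c computes F = ∀ {O} x → Eval O c (x ∷ []) (F x)

ifZero : ℕ → ℕ → ℕ → ℕ
ifZero zero    u v = u
ifZero (suc _) u v = v

ifZeroCode : Code 3
ifZeroCode = prec (prj zero) (prj (suc (suc (suc zero))))

ifZeroCode-eval : ∀ {O} p u v → Eval O ifZeroCode (p ∷ u ∷ v ∷ []) (ifZero p u v)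
ifZeroCode-eval zero    u v = ev-prec0 ev-prj
ifZeroCode-eval (suc p) u v = ev-precS (ifZeroCode-eval p u v) ev-prj

isZero : ℕ → ℕ
isZero n = ifZero n 1 0

isZeroCode : Code 1
isZeroCode = prec (comp succ (zer ∷ [])) zer

isZeroCode-computes : isZeroCode computes isZero
isZeroCode-computes zero    = ev-prec0 (ev-comp (ev-zer ∷ []) ev-succ)
isZeroCode-computes (suc x) = ev-precS (isZeroCode-computes x) ev-zer

parity : ℕ → ℕ
parity zero    = 0
parity (suc n) = isZero (parity n)

parityCode : Code 1
parityCode = prec zer (comp isZeroCode (prj (suc zero) ∷ []))

parityCode-computes : parityCode computes parity
parityCode-computes zero    = ev-prec0 ev-zer
parityCode-computes (suc n) =
  ev-precS (parityCode-computes n) (ev-comp (ev-prj ∷ []) (isZeroCode-computes (parity n)))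

half : ℕ → ℕ
half zero    = 0
half (suc n) = ifZero (parity n) (half n) (suc (half n))

halfCode : Code 1
halfCode = prec zer (comp ifZeroCode (comp parityCode (prj zero ∷ []) ∷ prj (suc zero)
                                      ∷ comp succ (prj (suc zero) ∷ []) ∷ []))

halfCode-computes : halfCode computes half
halfCode-computes zero    = ev-prec0 ev-zer
halfCode-computes (suc n) = ev-precS (halfCode-computes n)
  (ev-comp (ev-comp (ev-prj ∷ []) (parityCode-computes n) ∷ ev-prj ∷ ev-comp (ev-prj ∷ []) ev-succ ∷ [])
           (ifZeroCode-eval _ _ _))

double : ℕ → ℕ
double zero    = 0
double (suc n) = suc (suc (double n))

doubleCode : Code 1
doubleCode = prec zer (comp succ (comp succ (prj (suc zero) ∷ []) ∷ []))

doubleCode-computes : doubleCode computes double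
doubleCode-computes zero    = ev-prec0 ev-zer
doubleCode-computes (suc n) =
  ev-precS (doubleCode-computes n) (ev-comp (ev-comp (ev-prj ∷ []) ev-succ ∷ []) ev-succ)

parity-+2 : ∀ n → parity (suc (suc n)) ≡ parity n
parity-+2 zero    = refl
parity-+2 (suc n) = cong isZero (parity-+2 n)

ifZero-suc : ∀ p u v → ifZero p (suc u) (suc v) ≡ suc (ifZero p u v)
ifZero-suc zero    u v = refl
ifZero-suc (suc p) u v = refl

half-+2 : ∀ n → half (suc (suc n)) ≡ suc (half n)
half-+2 zero = refl
half-+2 (suc n) rewrite parity-+2 n | half-+2 n = ifZero-suc (parity n) (half n) (suc (half n))

⊕-double : ∀ (a b : Baire) n → (a ⊕ b) (double n) ≡ a n
⊕-double a b zero    = refl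
⊕-double a b (suc n) = ⊕-double (λ k → a (suc k)) (λ k → b (suc k)) n

⊕-suc-double : ∀ (a b : Baire) n → (a ⊕ b) (suc (double n)) ≡ b n
⊕-suc-double a b zero    = refl
⊕-suc-double a b (suc n) = ⊕-suc-double (λ k → a (suc k)) (λ k → b (suc k)) n

⊕-decode : ∀ (a b : Baire) x → (a ⊕ b) x ≡ ifZero (parity x) (a (half x)) (b (half x))
⊕-decode a b zero          = refl
⊕-decode a b (suc zero)    = refl
⊕-decode a b (suc (suc x)) rewrite parity-+2 x | half-+2 x =
  ⊕-decode (λ k → a (suc k)) (λ k → b (suc k)) x

≤T-⊕ˡ : ∀ a b → a ≤T (a ⊕ b)
≤T-⊕ˡ a b = comp orc (doubleCode ∷ []) , λ n →
  subst (Eval (a ⊕ b) _ _) (⊕-double a b n) (ev-comp (doubleCode-computes n ∷ []) ev-orc)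

≤T-⊕ʳ : ∀ a b → b ≤T (a ⊕ b)
≤T-⊕ʳ a b = comp orc (comp succ (doubleCode ∷ []) ∷ []) , λ n →
  subst (Eval (a ⊕ b) _ _) (⊕-suc-double a b n)
    (ev-comp (ev-comp (doubleCode-computes n ∷ []) ev-succ ∷ []) ev-orc)

⊕-lub : ∀ {a b c} → a ≤T c → b ≤T c → (a ⊕ b) ≤T c
⊕-lub {a} {b} {c} (ca , ca-computes-a) (cb , cb-computes-b) =
  comp ifZeroCode (comp parityCode (prj zero ∷ []) ∷ at-half ca ∷ at-half cb ∷ []) ,
  λ x → subst (Eval c _ _) (sym (⊕-decode a b x))
    (ev-comp (ev-comp (ev-prj ∷ []) (parityCode-computes x)
              ∷ ev-comp (half-arg x) (ca-computes-a (half x))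
              ∷ ev-comp (half-arg x) (cb-computes-b (half x)) ∷ [])
             (ifZeroCode-eval _ _ _))
  where
  at-half : Code 1 → Code 1
  at-half d = comp d (comp halfCode (prj zero ∷ []) ∷ [])

  half-arg : ∀ x → EvalAll c (comp halfCode (prj zero ∷ []) ∷ []) (x ∷ []) (half x ∷ [])
  half-arg x = ev-comp (ev-prj ∷ []) (halfCode-computes x) ∷ []

⊕-monoʳ-≤T : ∀ {g h₁ h} → h₁ ≤T h → (g ⊕ h₁) ≤T (g ⊕ h)
⊕-monoʳ-≤T {g} {h₁} {h} h₁≤h = ⊕-lub (≤T-⊕ˡ g h) (≤T-trans h₁≤h (≤T-⊕ʳ g h))

module _ {A : Baire → Set} (dc : DownClosed A) where

  ⊕-below-∈ : ∀ {g h} → A h → g ≤T h → A (g ⊕ h)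
  ⊕-below-∈ Ah g≤h = dc _ _ Ah (⊕-lub g≤h ≤T-refl)

  ⊕-∉-≤T-mono : ∀ {g h₁ h} → h₁ ≤T h → ¬ A (g ⊕ h₁) → ¬ A (g ⊕ h)
  ⊕-∉-≤T-mono h₁≤h g⊕h₁∉A A[g⊕h] = g⊕h₁∉A (dc _ _ A[g⊕h] (⊕-monoʳ-≤T h₁≤h))

  ⊕-∉⇒≰T : ∀ {g h} → A h → ¬ A (g ⊕ h) → ¬ (g ≤T h)
  ⊕-∉⇒≰T Ah g⊕h∉A g≤h = g⊕h∉A (⊕-below-∈ Ah g≤h)

  splitting⇒conditionII : SplittingCondition A → ConditionII A
  splitting⇒conditionII split f Af B B-above-f
    with split f Af B B-above-f
  ... | h₀ , h₁ , Ah₀ , Ah₁ , f≤h₀ , f≤h₁ , h₀⊕h₁∉A , B-avoids =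
    h₀ , Ah₀ , (f≤h₀ , λ h₀≤f → ⊕-∉⇒≰T Ah₁ h₀⊕h₁∉A (≤T-trans h₀≤f f≤h₁)) ,
    All.map proj₁ B-avoids

  conditionII⇒splitting : ConditionII A → SplittingCondition A
  conditionII⇒splitting condII f Af B B-above-f
    with condII f Af B B-above-f
  ... | h₀ , Ah₀ , (f≤h₀ , h₀≰f) , B-avoids-h₀
    with condII f Af (h₀ ∷ B) ((Ah₀ , h₀≰f) ∷ B-above-f)
  ... | h₁ , Ah₁ , (f≤h₁ , _) , h₀⊕h₁∉A ∷ B-avoids-h₁ =
    h₀ , h₁ , Ah₀ , Ah₁ , f≤h₀ , f≤h₁ , h₀⊕h₁∉A , All.zip (B-avoids-h₀ , B-avoids-h₁)

  conditionII⇒conditionIII : ConditionII A → ConditionIII A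
  conditionII⇒conditionIII condII = not-maximal , split-off
    where
    not-maximal : ∀ f → A f → Σ Baire λ h → A h × ¬ (h ≤T f)
    not-maximal f Af with condII f Af [] []
    ... | h , Ah , (_ , h≰f) , _ = h , Ah , h≰f

    split-off : ∀ f → A f → ∀ B → FinSubAbove A f B → ∀ h₀ → A h₀ → ¬ (h₀ ≤T f) →
                Σ Baire λ h₁ → A h₁ × f <T h₁ × ¬ A (h₀ ⊕ h₁) × All (λ g → ¬ (g ≤T h₁)) B
    split-off f Af B B-above-f h₀ Ah₀ h₀≰f
      with condII f Af (h₀ ∷ B) ((Ah₀ , h₀≰f) ∷ B-above-f)
    ... | h₁ , Ah₁ , f<h₁ , h₀⊕h₁∉A ∷ B-avoids =
      h₁ , Ah₁ , f<h₁ , h₀⊕h₁∉A , All.map (⊕-∉⇒≰T Ah₁) B-avoids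

  conditionIII⇒conditionII : ConditionIII A → ConditionII A
  conditionIII⇒conditionII (not-maximal , split-off) = go
    where
    go : ConditionII A
    go f Af [] []
      with not-maximal f Af
    ... | h₀ , Ah₀ , h₀≰f
      with split-off f Af [] [] h₀ Ah₀ h₀≰f
    ... | h , Ah , f<h , _ , _ = h , Ah , f<h , []
    go f Af (g ∷ B) ((Ag , g≰f) ∷ B-above-f)
      with split-off f Af B B-above-f g Ag g≰f
    ... | h₁ , Ah₁ , f<h₁ , g⊕h₁∉A , B≰h₁
      with go h₁ Ah₁ B (All.zipWith (λ ((Ag′ , _) , g′≰h₁) → Ag′ , g′≰h₁) (B-above-f , B≰h₁))
    ... | h , Ah , h₁<h , B-avoids =
      h , Ah , <T-≤T-trans f<h₁ (proj₁ h₁<h) , ⊕-∉-≤T-mono (proj₁ h₁<h) g⊕h₁∉A ∷ B-avoids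

proposition3p2 : (A : Baire → Set) → NonEmpty A → Countable A → DownClosed A →
                 (IsSplittingClass A ⇔ ConditionII A) × (ConditionII A ⇔ ConditionIII A)
proposition3p2 A ne co dc =
  mk⇔ (λ (_ , _ , _ , split) → splitting⇒conditionII dc split)
      (λ condII → ne , co , dc , conditionII⇒splitting dc condII) ,
  mk⇔ (conditionII⇒conditionIII dc) (conditionIII⇒conditionII dc)
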